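{- Let $H$ be a graph and let $H'$ be obtained from $H$ by adding an isolated vertex. If $f(H,P_5)=R_3(H)$, then $f(H',P_5)=R_3(H')$.
   Context: $P_5$ is the path on $5$ vertices. Monochromatic: all edges same color; rainbow: all edges distinct colors. $f(H,G)$ is the minimum $n$ such that every edge-coloring of $K_n$ with any number of colors contains a monochromatic copy of $H$ or a rainbow copy of $G$. $R_3(H)$ is the minimum $n$ such that every coloring of $E(K_n)$ with colors from $\{1,2,3\}$ (not all need be used) contains a monochromatic $H$. -}

module Defs where

open import Data.Nat using (ℕ; zero; suc; _<_)
open import Data.Fin using (Fin; zero; suc)
open import Data.Bool using (Bool; true; false; T)
open import Data.Product using (Σ; ∃; _×_; _,_)
open import Data.Sum using (_⊎_)
open import Relation.Binary.PropositionalEquality using (_≡_; refl)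
open import Relation.Nullary using (¬_)
open import Function.Definitions using (Injective)

record Graph : Set where
  field
    order : ℕ
    adj   : Fin order → Fin order → Bool
    sym   : ∀ u v → adj u v ≡ adj v u
    irrefl : ∀ u → adj u u ≡ false
open Graph public

Adj : (H : Graph) → Fin (order H) → Fin (order H) → Set
Adj H u v = T (adj H u v)

-- H' : H plus one new isolated vertex (the vertex zero; old vertices are suc _).
addIsolated : Graph → Graph
addIsolated H = record { order = suc (order H) ; adj = a ; sym = s ; irrefl = i }
  where
  a : Fin (suc (order H)) → Fin (suc (order H)) → Bool
  a zero    _       = false
  a (suc _) zero    = false
  a (suc u) (suc v) = adj H u v
  s : ∀ u v → a u v ≡ a v u
  s zero zero = refl
  s zero (suc v) = refl
  s (suc u) zero = refl
  s (suc u) (suc v) = sym H u v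
  i : ∀ u → a u u ≡ false
  i zero = refl
  i (suc u) = irrefl H u

p5adj : Fin 5 → Fin 5 → Bool
p5adj zero (suc zero) = true
p5adj (suc zero) zero = true
p5adj (suc zero) (suc (suc zero)) = true
p5adj (suc (suc zero)) (suc zero) = true
p5adj (suc (suc zero)) (suc (suc (suc zero))) = true
p5adj (suc (suc (suc zero))) (suc (suc zero)) = true
p5adj (suc (suc (suc zero))) (suc (suc (suc (suc zero)))) = true
p5adj (suc (suc (suc (suc zero)))) (suc (suc (suc zero))) = true
p5adj _ _ = false

P5 : Graph
P5 = record { order = 5 ; adj = p5adj ; sym = s ; irrefl = i }
  where
  s : ∀ u v → p5adj u v ≡ p5adj v u
  s zero zero = refl
  s zero (suc zero) = refl
  s zero (suc (suc zero)) = refl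
  s zero (suc (suc (suc zero))) = refl
  s zero (suc (suc (suc (suc zero)))) = refl
  s (suc zero) zero = refl
  s (suc zero) (suc zero) = refl
  s (suc zero) (suc (suc zero)) = refl
  s (suc zero) (suc (suc (suc zero))) = refl
  s (suc zero) (suc (suc (suc (suc zero)))) = refl
  s (suc (suc zero)) zero = refl
  s (suc (suc zero)) (suc zero) = refl
  s (suc (suc zero)) (suc (suc zero)) = refl
  s (suc (suc zero)) (suc (suc (suc zero))) = refl
  s (suc (suc zero)) (suc (suc (suc (suc zero)))) = refl
  s (suc (suc (suc zero))) zero = refl
  s (suc (suc (suc zero))) (suc zero) = refl
  s (suc (suc (suc zero))) (suc (suc zero)) = refl
  s (suc (suc (suc zero))) (suc (suc (suc zero))) = refl
  s (suc (suc (suc zero))) (suc (suc (suc (suc zero)))) = refl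
  s (suc (suc (suc (suc zero)))) zero = refl
  s (suc (suc (suc (suc zero)))) (suc zero) = refl
  s (suc (suc (suc (suc zero)))) (suc (suc zero)) = refl
  s (suc (suc (suc (suc zero)))) (suc (suc (suc zero))) = refl
  s (suc (suc (suc (suc zero)))) (suc (suc (suc (suc zero)))) = refl
  i : ∀ u → p5adj u u ≡ false
  i zero = refl
  i (suc zero) = refl
  i (suc (suc zero)) = refl
  i (suc (suc (suc zero))) = refl
  i (suc (suc (suc (suc zero)))) = refl

-- An edge-coloring of K_n with colors in C: a symmetric function on pairs
-- (values on the diagonal are irrelevant).
record Coloring (n : ℕ) (C : Set) : Set where
  field
    col    : Fin n → Fin n → C
    colSym : ∀ i j → col i j ≡ col j i
open Coloring public

-- A copy of H in K_n: an injective map of vertices.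
Embedding : (H : Graph) (n : ℕ) → Set
Embedding H n = Σ (Fin (order H) → Fin n) Injective′
  where
  Injective′ : (Fin (order H) → Fin n) → Set
  Injective′ φ = Injective _≡_ _≡_ φ

MonoCopy : {n : ℕ} {C : Set} → Graph → Coloring n C → Set
MonoCopy {n} {C} H c = Σ (Embedding H n) λ { (φ , _) →
  ∃ λ (a : C) → ∀ u v → Adj H u v → col c (φ u) (φ v) ≡ a }

RainbowCopy : {n : ℕ} {C : Set} → Graph → Coloring n C → Set
RainbowCopy {n} G c = Σ (Embedding G n) λ { (φ , _) →
  ∀ u v x y → Adj G u v → Adj G x y →
    col c (φ u) (φ v) ≡ col c (φ x) (φ y) →
    (u ≡ x × v ≡ y) ⊎ (u ≡ y × v ≡ x) }

IsLeast : (ℕ → Set) → ℕ → Set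
IsLeast P n = P n × (∀ m → m < n → ¬ P m)

-- "every coloring of K_n with any number of colors has a monochromatic H or rainbow G"
-- (colors drawn from ℕ: any finite set of colors embeds in ℕ).
ArrowsFG : Graph → Graph → ℕ → Set
ArrowsFG H G n = (c : Coloring n ℕ) → MonoCopy H c ⊎ RainbowCopy G c

Arrows3 : Graph → ℕ → Set
Arrows3 H n = (c : Coloring n (Fin 3)) → MonoCopy H c

IsF : Graph → Graph → ℕ → Set
IsF H G = IsLeast (ArrowsFG H G)

IsR3 : Graph → ℕ → Set
IsR3 H = IsLeast (Arrows3 H)

FEqualsR3 : Graph → Graph → Set
FEqualsR3 H G = ∃ λ n → IsF H G n × IsR3 H n

{-# OPTIONS --safe #-}
module Submission where

open import Defs
open import Data.Nat using (ℕ; suc; _<_; _≤_; _⊔_)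
open import Data.Nat.Properties using (m≤m⊔n; m≤n⊔m; ⊔-lub; ≤⇒≯; ≮⇒≥)
open import Data.Fin using (Fin; zero; suc; inject≤; _≟_)
open import Data.Fin.Properties
  using (suc-injective; inject≤-injective; injective⇒≤; <⇒notInjective; ¬∀⟶∃¬; any?)
open import Data.Product using (∃; _×_; _,_; proj₁; proj₂; map₂)
open import Data.Sum using (inj₁; inj₂; [_,_]′)
open import Function using (_∘_; _⇔_; mk⇔; Equivalence)
open import Function.Definitions using (Injective)
open import Relation.Binary.PropositionalEquality using (_≡_; _≢_; refl; trans; cong)
import Relation.Binary.PropositionalEquality as ≡
open import Relation.Nullary using (¬_; contradiction)

-- H' has a monochromatic copy in a coloring of K_m exactly when H does and
-- m ≥ |H| + 1, since the isolated vertex can go to any vertex unused by the copy of H.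
-- A constant coloring has no rainbow P₅, so both f(H',P₅) and R₃(H') equal
-- max(m₀, |H| + 1), where m₀ = f(H,P₅) = R₃(H).

IsLeast-⊔ : {P Q : ℕ → Set} {n : ℕ} (k : ℕ) →
            (∀ {m m′} → m ≤ m′ → P m → P m′) →
            (∀ m → Q m ⇔ (P m × k ≤ m)) →
            IsLeast P n → IsLeast Q (n ⊔ k)
IsLeast-⊔ {P} {Q} {n} k P-mono Q⇔P×k≤ (Pn , n-least) = Q[n⊔k] , n⊔k-least
  where
  Q[n⊔k] : Q (n ⊔ k)
  Q[n⊔k] = Equivalence.from (Q⇔P×k≤ (n ⊔ k)) (P-mono (m≤m⊔n n k) Pn , m≤n⊔m n k)

  n⊔k-least : ∀ m → m < n ⊔ k → ¬ Q m
  n⊔k-least m m<n⊔k Qm with Equivalence.to (Q⇔P×k≤ m) Qm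
  ... | Pm , k≤m = ≤⇒≯ (⊔-lub (≮⇒≥ λ m<n → n-least m m<n Pm) k≤m) m<n⊔k

Embedding-∘ : ∀ {H m n} (ι : Fin m → Fin n) →
              Injective _≡_ _≡_ ι → Embedding H m → Embedding H n
Embedding-∘ ι ι-inj (φ , φ-inj) = ι ∘ φ , φ-inj ∘ ι-inj

restrict : ∀ {m n C} → (Fin m → Fin n) → Coloring n C → Coloring m C
restrict ι c = record { col = λ i j → col c (ι i) (ι j) ; colSym = λ i j → colSym c (ι i) (ι j) }

restrict-MonoCopy : ∀ {m n C H} (ι : Fin m → Fin n) (c : Coloring n C) →
                    Injective _≡_ _≡_ ι → MonoCopy H (restrict ι c) → MonoCopy H c
restrict-MonoCopy {H = H} ι c ι-inj (φ , mono) = Embedding-∘ {H} ι ι-inj φ , mono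

restrict-RainbowCopy : ∀ {m n C G} (ι : Fin m → Fin n) (c : Coloring n C) →
                       Injective _≡_ _≡_ ι → RainbowCopy G (restrict ι c) → RainbowCopy G c
restrict-RainbowCopy {G = G} ι c ι-inj (φ , rainbow) = Embedding-∘ {G} ι ι-inj φ , rainbow

inject≤-Injective : ∀ {m n} (m≤n : m ≤ n) → Injective _≡_ _≡_ (λ i → inject≤ i m≤n)
inject≤-Injective m≤n = inject≤-injective m≤n m≤n _ _

ArrowsFG-mono : ∀ {H G m n} → m ≤ n → ArrowsFG H G m → ArrowsFG H G n
ArrowsFG-mono {H} {G} m≤n arrows c =
  [ inj₁ ∘ restrict-MonoCopy {H = H} ι c ι-inj , inj₂ ∘ restrict-RainbowCopy {G = G} ι c ι-inj ]′
    (arrows (restrict ι c))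
  where
  ι = λ i → inject≤ i m≤n
  ι-inj = inject≤-Injective m≤n

Arrows3-mono : ∀ {H m n} → m ≤ n → Arrows3 H m → Arrows3 H n
Arrows3-mono {H} m≤n arrows c =
  restrict-MonoCopy {H = H} ι c (inject≤-Injective m≤n) (arrows (restrict ι c))
  where ι = λ i → inject≤ i m≤n

-- If every vertex were hit, choosing preimages would inject Fin n into Fin k.
missed-vertex : ∀ {k n} {φ : Fin k → Fin n} → Injective _≡_ _≡_ φ → k < n →
                ∃ λ v → ∀ u → φ u ≢ v
missed-vertex {k} {n} {φ} φ-inj k<n =
  map₂ (λ v-unhit u eq → v-unhit (u , eq))
    (¬∀⟶∃¬ n (λ v → ∃ λ u → φ u ≡ v) (λ v → any? (λ u → φ u ≟ v)) surjective-impossible)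
  where
  surjective-impossible : ¬ (∀ v → ∃ λ u → φ u ≡ v)
  surjective-impossible surj = <⇒notInjective k<n preimage-inj
    where
    preimage-inj : Injective _≡_ _≡_ (proj₁ ∘ surj)
    preimage-inj {a} {b} eq = trans (≡.sym (proj₂ (surj a))) (trans (cong φ eq) (proj₂ (surj b)))

MonoCopy-addIsolated⁻ : ∀ {n C H} (c : Coloring n C) → MonoCopy (addIsolated H) c → MonoCopy H c
MonoCopy-addIsolated⁻ c ((φ , φ-inj) , a , mono) =
  (φ ∘ suc , suc-injective ∘ φ-inj) , a , λ u v → mono (suc u) (suc v)

MonoCopy-addIsolated⁺ : ∀ {n C H} (c : Coloring n C) →
                        order H < n → MonoCopy H c → MonoCopy (addIsolated H) c
MonoCopy-addIsolated⁺ {n} {H = H} c |H|<n ((φ , φ-inj) , a , mono) =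
  (φ′ , φ′-inj) , a , mono′
  where
  v = proj₁ (missed-vertex φ-inj |H|<n)
  v-missed = proj₂ (missed-vertex φ-inj |H|<n)

  φ′ : Fin (suc (order H)) → Fin n
  φ′ zero    = v
  φ′ (suc u) = φ u

  φ′-inj : Injective _≡_ _≡_ φ′
  φ′-inj {zero}  {zero}  _  = refl
  φ′-inj {zero}  {suc y} eq with () ← v-missed y (≡.sym eq)
  φ′-inj {suc x} {zero}  eq with () ← v-missed x eq
  φ′-inj {suc x} {suc y} eq = cong suc (φ-inj eq)

  mono′ : ∀ u w → Adj (addIsolated H) u w → col c (φ′ u) (φ′ w) ≡ a
  mono′ zero    _       ()
  mono′ (suc u) zero    ()
  mono′ (suc u) (suc w) = mono u w

MonoCopy-addIsolated⇒order< : ∀ {n C H} (c : Coloring n C) →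
                              MonoCopy (addIsolated H) c → order H < n
MonoCopy-addIsolated⇒order< c ((_ , φ-inj) , _) = injective⇒≤ φ-inj

constant : ∀ {n C} → C → Coloring n C
constant a = record { col = λ _ _ → a ; colSym = λ _ _ → refl }

constant-¬RainbowCopy-P5 : ∀ {n} → ¬ RainbowCopy P5 (constant {n} 0)
constant-¬RainbowCopy-P5 (_ , rainbow)
  with rainbow zero (suc zero) (suc zero) (suc (suc zero)) _ _ refl
... | inj₁ (() , _)
... | inj₂ (() , _)

ArrowsFG-addIsolated : ∀ {H} m → ArrowsFG (addIsolated H) P5 m ⇔ (ArrowsFG H P5 m × order H < m)
ArrowsFG-addIsolated {H} m = mk⇔ to from
  where
  to : ArrowsFG (addIsolated H) P5 m → ArrowsFG H P5 m × order H < m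
  to arrows =
    (λ c → [ inj₁ ∘ MonoCopy-addIsolated⁻ c , inj₂ ]′ (arrows c)) ,
    [ MonoCopy-addIsolated⇒order< (constant 0) , (λ rainbow → contradiction rainbow constant-¬RainbowCopy-P5) ]′
      (arrows (constant 0))
  from : ArrowsFG H P5 m × order H < m → ArrowsFG (addIsolated H) P5 m
  from (arrows , |H|<m) c = [ inj₁ ∘ MonoCopy-addIsolated⁺ c |H|<m , inj₂ ]′ (arrows c)

Arrows3-addIsolated : ∀ {H} m → Arrows3 (addIsolated H) m ⇔ (Arrows3 H m × order H < m)
Arrows3-addIsolated {H} m = mk⇔ to from
  where
  to : Arrows3 (addIsolated H) m → Arrows3 H m × order H < m
  to arrows =
    (λ c → MonoCopy-addIsolated⁻ c (arrows c)) ,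
    MonoCopy-addIsolated⇒order< (constant zero) (arrows (constant zero))
  from : Arrows3 H m × order H < m → Arrows3 (addIsolated H) m
  from (arrows , |H|<m) c = MonoCopy-addIsolated⁺ c |H|<m (arrows c)

proposition2p1 : (H : Graph) → FEqualsR3 H P5 → FEqualsR3 (addIsolated H) P5
proposition2p1 H (n , isF , isR3) =
  n ⊔ suc (order H) ,
  IsLeast-⊔ (suc (order H)) (ArrowsFG-mono {H} {P5}) ArrowsFG-addIsolated isF ,
  IsLeast-⊔ (suc (order H)) (Arrows3-mono {H}) Arrows3-addIsolated isR3
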